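{- Let $L$ be the star graph on $\bar{n}+1$ vertices and $\bar{n}$ beams. Let $k\in\{1,\dots,\bar{n}\}$. The star graph $L$ has vertex connectivity $\kappa(L)=1$ and $\mathfrak{L}_k$ satisfies \begin{equation} \kappa(\mathfrak{L}_k) = \begin{cases} k,& k\leq \dfrac{\bar{n}+1}{2},\vspace{5pt}\\ \bar{n}+1-k,& k\geq \dfrac{\bar{n}+1}{2}. \end{cases} \end{equation}
   Context: For a finite simple graph $L=(V,E)$ and $k\in\{1,\dots,|V|-1\}$, the $k$-particle graph $\mathfrak{L}_k=(\mathfrak{V}_k,\mathfrak{E}_k)$ has vertex set $\mathfrak{V}_k$ consisting of all subsets of $V$ of size $k$, and $\langle\mathfrak{v},\mathfrak{w}\rangle\in\mathfrak{E}_k$ if and only if $\mathfrak{v}\triangle\mathfrak{w}=\{v,w\}$ with $\langle v,w\rangle\in E$. $\kappa$ denotes vertex connectivity. -}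

module Defs where

open import Data.Nat using (ℕ; zero; suc; _<_)
open import Data.Fin using (Fin; zero; suc)
open import Data.Fin.Subset using (Subset; _∈_; _∉_; ∣_∣)
open import Data.List using (List; length)
open import Data.List.Relation.Unary.Unique.Propositional using (Unique)
import Data.List.Membership.Propositional as LM
open import Data.Product using (Σ; _×_; _,_)
open import Data.Sum using (_⊎_)
open import Relation.Binary.PropositionalEquality using (_≡_; _≢_)
open import Relation.Nullary using (¬_)

record Graph : Set₁ where
  field
    V   : Set
    Adj : V → V → Set

module _ (G : Graph) where
  open Graph G

  data Reach (S : List V) : V → V → Set where
    here : ∀ {u} → ¬ (u LM.∈ S) → Reach S u u
    step : ∀ {u w x} → ¬ (u LM.∈ S) → Adj u w → Reach S w x → Reach S u x

  ConnectedWithout : List V → Set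
  ConnectedWithout S = ∀ u w → ¬ (u LM.∈ S) → ¬ (w LM.∈ S) → Reach S u w

  AtMostOneLeft : List V → Set
  AtMostOneLeft S = ∀ u w → ¬ (u LM.∈ S) → ¬ (w LM.∈ S) → u ≡ w

  Separating : List V → Set
  Separating S = (¬ ConnectedWithout S) ⊎ AtMostOneLeft S

  IsVertexConnectivity : ℕ → Set
  IsVertexConnectivity c =
    (Σ (List V) λ S → Unique S × length S ≡ c × Separating S) ×
    (∀ (S : List V) → Unique S → length S < c → ¬ Separating S)

StarAdj : (n : ℕ) → Fin (suc n) → Fin (suc n) → Set
StarAdj n u w = (u ≡ zero × w ≢ zero) ⊎ (w ≡ zero × u ≢ zero)

Star : ℕ → Graph
Star n = record { V = Fin (suc n) ; Adj = StarAdj n }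

SymDiffIs : ∀ {m} → Subset m → Subset m → Fin m → Fin m → Set
SymDiffIs v w a b =
  ∀ x → ((((x ∈ v) × (x ∉ w)) ⊎ ((x ∈ w) × (x ∉ v))) → (x ≡ a ⊎ x ≡ b)) ×
        ((x ≡ a ⊎ x ≡ b) → (((x ∈ v) × (x ∉ w)) ⊎ ((x ∈ w) × (x ∉ v))))

-- k-particle graph of a graph on Fin m: vertices are k-subsets,
-- adjacent iff symmetric difference is {a,b} with a ~ b in the base graph.
KSubset : ℕ → ℕ → Set
KSubset m k = Σ (Subset m) λ s → ∣ s ∣ ≡ k

ParticleGraph : (m : ℕ) → (Fin m → Fin m → Set) → ℕ → Graph
ParticleGraph m adj k = record
  { V   = KSubset m k
  ; Adj = λ { (v , _) (w , _) → Σ (Fin m) λ a → Σ (Fin m) λ b → adj a b × SymDiffIs v w a b }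
  }

module Submission where

-- A configuration of k particles on the star with n leaves has either the centre empty, and then
-- k neighbours (a particle jumps to the centre), or the centre occupied, and then h = n + 1 − k
-- neighbours (the centre particle jumps to a hole). The neighbourhood of an empty-centre
-- configuration separates it from the rest, so κ ≤ k; complementation, which exchanges particles
-- and holes, is an isomorphism between the k- and the (n + 1 − k)-particle graphs and reduces the
-- case 2k ≥ n + 1 to the case 2k ≤ n + 1.
-- Conversely, removing t < min(k, h) configurations leaves the graph connected, by induction on n:
-- split the configurations by the occupation of one leaf. The slice where that leaf is empty is the
-- graph for n − 1 leaves, hence connected by induction, and every surviving configuration reaches
-- it along one of more than t pairwise disjoint routes of length at most three. When the removed
-- configurations crowd that slice, complementation exchanges the roles of the two slices.

open import Defs
open import Data.Bool using (Bool; true; false; not)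
import Data.Bool as Bool
open import Data.Bool.Properties using (not-involutive; not-¬)
open import Data.Fin using (Fin; zero; suc)
import Data.Fin.Properties as Fin
open import Data.Fin.Subset using (∣_∣; ∁)
import Data.Fin.Subset as Subset
open import Data.Fin.Subset.Properties using (∣∁p∣≡n∸∣p∣)
open import Data.List using (List; []; _∷_; [_]; length; map; filter)
open import Data.List.Properties using (filter-notAll; length-map)
open import Data.List.Membership.Propositional using (_∈_; _∉_; find; lose)
open import Data.List.Membership.Propositional.Properties using (∈-filter⁺; ∈-map⁺; ∈-map⁻)
import Data.List.Membership.DecPropositional as DecMembership
open import Data.List.Relation.Binary.Disjoint.Propositional using (Disjoint)
open import Data.List.Relation.Unary.All using (All; []; _∷_)
import Data.List.Relation.Unary.All as All
import Data.List.Relation.Unary.All.Properties as All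
open import Data.List.Relation.Unary.All.Properties using (¬Any⇒All¬)
open import Data.List.Relation.Unary.AllPairs using (AllPairs; []; _∷_)
import Data.List.Relation.Unary.AllPairs as AllPairs
import Data.List.Relation.Unary.AllPairs.Properties as AllPairs
open import Data.List.Relation.Unary.Any using (here; there; any?)
open import Data.List.Relation.Unary.Unique.Propositional using (Unique)
import Data.List.Relation.Unary.Unique.Propositional.Properties as Unique
open import Data.Maybe using (Maybe; just; nothing)
open import Data.Nat using (ℕ; zero; suc; _+_; _*_; _∸_; _≤_; _<_; z≤n; s≤s; _<?_)
open import Data.Nat.Properties
  using ( ≤-refl; ≤-trans; ≤-pred; <⇒≤; <⇒≢; ≤-<-trans; <-≤-trans; ≮⇒≥; n≤1+n; n<1+n; m<n⇒m<1+n
        ; m≤m+n; m<m+n; n≤0⇒n≡0; n≢0⇒n>0; suc-injective; ≡-irrelevant; +-comm; +-suc; +-identityʳ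
        ; +-cancelʳ-≡; +-cancelˡ-≤; m+n≡0⇒m≡0; m+n≡0⇒n≡0; m+n∸m≡n; m+[n∸m]≡n; m<n⇒0<n∸m
        ; module ≤-Reasoning )
open import Data.Product using (Σ; ∃-syntax; _×_; _,_; proj₁; proj₂)
import Data.Product as Product
open import Data.Sum using (_⊎_; inj₁; inj₂; swap; [_,_]′; map₂)
open import Data.Vec using (Vec; []; _∷_; lookup; _[_]≔_)
import Data.Vec.Properties as Vec
open import Data.Vec.Properties
  using (lookup∘update; lookup∘update′; []=⇒lookup; lookup⇒[]=; tabulate∘lookup; tabulate-cong)
open import Function using (_on_; _∘_; id)
open import Relation.Binary using (DecidableEquality)
open import Relation.Binary.PropositionalEquality
  using (_≡_; _≢_; refl; sym; trans; cong; cong₂; subst; subst₂; module ≡-Reasoning)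
open import Relation.Nullary using (¬_; ¬?; yes; no; contradiction)
open import Relation.Nullary.Decidable using (decidable-stable)

module _ {G : Graph} where
  open Graph G

  reach-source∉ : ∀ {S u w} → Reach G S u w → u ∉ S
  reach-source∉ (here u∉S)     = u∉S
  reach-source∉ (step u∉S _ _) = u∉S

  reach-trans : ∀ {S u v w} → Reach G S u v → Reach G S v w → Reach G S u w
  reach-trans (here _)       q = q
  reach-trans (step u∉S a p) q = step u∉S a (reach-trans p q)

  reach-sym : (∀ {a b} → Adj a b → Adj b a) → ∀ {S u w} → Reach G S u w → Reach G S w u
  reach-sym adj-sym (here u∉S)     = here u∉S
  reach-sym adj-sym (step u∉S a p) =
    reach-trans (reach-sym adj-sym p) (step (reach-source∉ p) (adj-sym a) (here u∉S))

  unreachable-if-isolated : ∀ {S u w} → (∀ v → Adj u v → v ∈ S) → u ≢ w → ¬ Reach G S u w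
  unreachable-if-isolated _   u≢w (here _)               = u≢w refl
  unreachable-if-isolated iso _   (step _ a (here v∉S))     = v∉S (iso _ a)
  unreachable-if-isolated iso _   (step _ a (step v∉S _ _)) = v∉S (iso _ a)

  isolated-separates : ∀ {S u w} → (∀ v → Adj u v → v ∈ S) → u ∉ S → w ∉ S → u ≢ w → Separating G S
  isolated-separates iso u∉S w∉S u≢w =
    inj₁ λ conn → unreachable-if-isolated iso u≢w (conn _ _ u∉S w∉S)

reach-map : ∀ {G H : Graph} (f : Graph.V G → Graph.V H) →
            (∀ {a b} → Graph.Adj G a b → Graph.Adj H (f a) (f b)) →
            ∀ {S S'} → (∀ {a} → f a ∈ S' → a ∈ S) →
            ∀ {u w} → Reach G S u w → Reach H S' (f u) (f w)
reach-map f f-adj pull (here u∉S)     = here (u∉S ∘ pull)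
reach-map f f-adj pull (step u∉S a p) = step (u∉S ∘ pull) (f-adj a) (reach-map f f-adj pull p)

-- Pigeonhole

module _ {A : Set} (_≟_ : DecidableEquality A) where
  open DecMembership _≟_ using (_∈?_)

  avoiding-member : ∀ {X : Set} (vs : X → List A) (T : List A) (C : List X) →
                    AllPairs (Disjoint on vs) C → length T < length C →
                    ∃[ x ] x ∈ C × All (_∉ T) (vs x)
  avoiding-member vs T (x ∷ C) (x#C ∷ C#) |T|<|C| with any? (_∈? T) (vs x)
  ... | no x-avoids = x , here refl , ¬Any⇒All¬ (vs x) x-avoids
  ... | yes x-meets with find x-meets
  ...   | a , a∈x , a∈T with avoiding-member vs (filter (λ b → ¬? (b ≟ a)) T) C C#
                           (≤-trans (filter-notAll (λ b → ¬? (b ≟ a)) T (lose a∈T λ a≢a → a≢a refl))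
                                    (≤-pred |T|<|C|))
  ...     | y , y∈C , y-avoids = y , there y∈C , All.tabulate avoids-T
    where
      avoids-T : ∀ {b} → b ∈ vs y → b ∉ T
      avoids-T {b} b∈y b∈T with b ≟ a
      ... | yes refl = All.lookup x#C y∈C (a∈x , b∈y)
      ... | no b≢a   = All.lookup y-avoids b∈y (∈-filter⁺ (λ b → ¬? (b ≟ a)) b∈T b≢a)

  singletons-disjoint : ∀ {xs : List A} → Unique xs → AllPairs (Disjoint on [_]) xs
  singletons-disjoint = AllPairs.map λ { x≢y (here refl , here refl) → x≢y refl }

  two-avoiding : (T xs : List A) → Unique xs → 2 + length T ≤ length xs →
                 ∃[ y ] ∃[ y' ] y ∉ T × y' ∉ T × y ≢ y'
  two-avoiding T xs xs! 2+|T|≤|xs|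
    with avoiding-member [_] T xs (singletons-disjoint xs!) (≤-trans (n≤1+n _) 2+|T|≤|xs|)
  ... | y , _ , y∉T ∷ [] with avoiding-member [_] (y ∷ T) xs (singletons-disjoint xs!) 2+|T|≤|xs|
  ...   | y' , _ , y'∉y∷T ∷ [] = y , y' , y∉T , y'∉y∷T ∘ there , λ y≡y' → y'∉y∷T (here (sym y≡y'))

not-atMostOneLeft : ∀ {G : Graph} → DecidableEquality (Graph.V G) →
                    ∀ {S xs} → Unique xs → 2 + length S ≤ length xs → ¬ AtMostOneLeft G S
not-atMostOneLeft _≟_ xs! bound atMostOne with two-avoiding _≟_ _ _ xs! bound
... | y , y' , y∉S , y'∉S , y≢y' = y≢y' (atMostOne y y' y∉S y'∉S)

-- Graph isomorphisms

record _≅_ (G H : Graph) : Set where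
  field
    to       : Graph.V G → Graph.V H
    from     : Graph.V H → Graph.V G
    from∘to  : ∀ v → from (to v) ≡ v
    to∘from  : ∀ v → to (from v) ≡ v
    to-adj   : ∀ {a b} → Graph.Adj G a b → Graph.Adj H (to a) (to b)
    from-adj : ∀ {a b} → Graph.Adj H a b → Graph.Adj G (from a) (from b)

  to-injective : ∀ {a b} → to a ≡ to b → a ≡ b
  to-injective {a} {b} eq = trans (sym (from∘to a)) (trans (cong from eq) (from∘to b))

≅-sym : ∀ {G H} → G ≅ H → H ≅ G
≅-sym i = record
  { to = from ; from = to ; from∘to = to∘from ; to∘from = from∘to ; to-adj = from-adj ; from-adj = to-adj }
  where open _≅_ i

module _ {G H : Graph} (i : G ≅ H) where
  open _≅_ i

  to-∉ : ∀ {S u} → u ∉ S → to u ∉ map to S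
  to-∉ u∉S tu∈ with ∈-map⁻ to tu∈
  ... | x , x∈S , tu≡tx = u∉S (subst (_∈ _) (sym (to-injective tu≡tx)) x∈S)

  separating-image : ∀ {S} → Separating G S → Separating H (map to S)
  separating-image (inj₁ disconnected) = inj₁ λ connected → disconnected λ u w u∉S w∉S →
    subst₂ (Reach G _) (from∘to u) (from∘to w)
      (reach-map from from-adj pull (connected (to u) (to w) (to-∉ u∉S) (to-∉ w∉S)))
    where
      pull : ∀ {a} → from a ∈ _ → a ∈ map to _
      pull {a} fa∈S = subst (_∈ _) (to∘from a) (∈-map⁺ to fa∈S)
  separating-image (inj₂ atMostOne) = inj₂ λ u w u∉ w∉ →
    trans (sym (to∘from u)) (trans (cong to (atMostOne (from u) (from w) (pulled u∉) (pulled w∉))) (to∘from w))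
    where
      pulled : ∀ {u S} → u ∉ map to S → from u ∉ S
      pulled {u} u∉ fu∈S = u∉ (subst (_∈ _) (to∘from u) (∈-map⁺ to fu∈S))

vertexConnectivity-≅ : ∀ {G H c} → G ≅ H → IsVertexConnectivity G c → IsVertexConnectivity H c
vertexConnectivity-≅ {c = c} i ((S , S! , |S|≡c , S-separates) , no-smaller) =
  (map to S , Unique.map⁺ to-injective S! , trans (length-map to S) |S|≡c , separating-image i S-separates) ,
  λ S' S'! |S'|<c S'-separates →
    no-smaller (map from S') (Unique.map⁺ (_≅_.to-injective (≅-sym i)) S'!)
      (subst (_< c) (sym (length-map from S')) |S'|<c) (separating-image (≅-sym i) S'-separates)
  where open _≅_ i

data Fill : ∀ {m} → Vec Bool m → Vec Bool m → Set where
  fill-here  : ∀ {m} {l : Vec Bool m} → Fill (false ∷ l) (true ∷ l)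
  fill-there : ∀ {m b} {l l' : Vec Bool m} → Fill l l' → Fill (b ∷ l) (b ∷ l')

-- A configuration on the star with n leaves is a Vec Bool (suc n) whose head is the centre.
data Hop {n : ℕ} : Vec Bool (suc n) → Vec Bool (suc n) → Set where
  hop-out : ∀ {l l'} → Fill l l' → Hop (true ∷ l) (false ∷ l')
  hop-in  : ∀ {l l'} → Fill l l' → Hop (false ∷ l') (true ∷ l)

HopGraph : ℕ → Graph
HopGraph n = record { V = Vec Bool (suc n) ; Adj = Hop {n} }

hop-sym : ∀ {n} {u w : Vec Bool (suc n)} → Hop u w → Hop w u
hop-sym (hop-out f) = hop-in f
hop-sym (hop-in f)  = hop-out f

∣∣-fill : ∀ {m} {l l' : Vec Bool m} → Fill l l' → ∣ l' ∣ ≡ suc ∣ l ∣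
∣∣-fill fill-here                  = refl
∣∣-fill (fill-there {b = true} f)  = cong suc (∣∣-fill f)
∣∣-fill (fill-there {b = false} f) = ∣∣-fill f

∣∣-hop : ∀ {n} {u w : Vec Bool (suc n)} → Hop u w → ∣ u ∣ ≡ ∣ w ∣
∣∣-hop (hop-out f) = sym (∣∣-fill f)
∣∣-hop (hop-in f)  = ∣∣-fill f

∣∣-reach : ∀ {n S} {u w : Vec Bool (suc n)} → Reach (HopGraph n) S u w → ∣ u ∣ ≡ ∣ w ∣
∣∣-reach (here _)     = refl
∣∣-reach (step _ h p) = trans (∣∣-hop h) (∣∣-reach p)

fill-at : ∀ {m} (l : Vec Bool m) j → lookup l j ≡ false → Fill l (l [ j ]≔ true)
fill-at (false ∷ l) zero    refl = fill-here
fill-at (x ∷ l)     (suc j) e    = fill-there (fill-at l j e)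

vacate-at : ∀ {m} (l : Vec Bool m) j → lookup l j ≡ true → Fill (l [ j ]≔ false) l
vacate-at (true ∷ l) zero    refl = fill-here
vacate-at (x ∷ l)    (suc j) e    = fill-there (vacate-at l j e)

fill⇒vacate : ∀ {m} {l r : Vec Bool m} → Fill l r → ∃[ i ] lookup r i ≡ true × l ≡ r [ i ]≔ false
fill⇒vacate fill-here = zero , refl , refl
fill⇒vacate (fill-there {b = b} f) with fill⇒vacate f
... | i , e , refl = suc i , e , refl

fill-∁ : ∀ {m} {l l' : Vec Bool m} → Fill l l' → Fill (∁ l') (∁ l)
fill-∁ fill-here      = fill-here
fill-∁ (fill-there f) = fill-there (fill-∁ f)

hop-∁ : ∀ {n} {u w : Vec Bool (suc n)} → Hop u w → Hop (∁ u) (∁ w)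
hop-∁ (hop-out f) = hop-in (fill-∁ f)
hop-∁ (hop-in f)  = hop-out (fill-∁ f)

∁-involutive : ∀ {m} (v : Vec Bool m) → ∁ (∁ v) ≡ v
∁-involutive []      = refl
∁-involutive (x ∷ v) = cong₂ _∷_ (not-involutive x) (∁-involutive v)

Position : ∀ {m} → Vec Bool m → Bool → Set
Position {m} r b = ∃[ i ] lookup r i ≡ b

suc-position : ∀ {m x b} {r : Vec Bool m} → Position r b → Position (x ∷ r) b
suc-position (i , e) = suc i , e

positions : ∀ {m} (b : Bool) (r : Vec Bool m) → List (Position r b)
positions b []      = []
positions b (x ∷ r) with x Bool.≟ b
... | yes x≡b = (zero , x≡b) ∷ map suc-position (positions b r)
... | no _    = map suc-position (positions b r)

length-positions-true : ∀ {m} (r : Vec Bool m) → length (positions true r) ≡ ∣ r ∣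
length-positions-true []          = refl
length-positions-true (true ∷ r)  = cong suc (trans (length-map _ (positions true r)) (length-positions-true r))
length-positions-true (false ∷ r) = trans (length-map _ (positions true r)) (length-positions-true r)

length-positions-false : ∀ {m} (r : Vec Bool m) → length (positions false r) + ∣ r ∣ ≡ m
length-positions-false []          = refl
length-positions-false (true ∷ r)  =
  trans (+-suc _ _)
        (cong suc (trans (cong (_+ ∣ r ∣) (length-map _ (positions false r))) (length-positions-false r)))
length-positions-false (false ∷ r) =
  cong suc (trans (cong (_+ ∣ r ∣) (length-map _ (positions false r))) (length-positions-false r))

positions-distinct : ∀ {m} b (r : Vec Bool m) → AllPairs (λ x y → proj₁ x ≢ proj₁ y) (positions b r)
positions-distinct b []      = []
positions-distinct b (x ∷ r) with x Bool.≟ b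
... | yes _ = All.map⁺ (All.universal (λ _ ()) _) ∷ AllPairs.map⁺ (AllPairs.map (_∘ Fin.suc-injective) distinct)
  where distinct = positions-distinct b r
... | no _  = AllPairs.map⁺ (AllPairs.map (_∘ Fin.suc-injective) (positions-distinct b r))

positions-complete : ∀ {m} b (r : Vec Bool m) i → lookup r i ≡ b → ∃[ e ] (i , e) ∈ positions b r
positions-complete b (x ∷ r) zero x≡b with x Bool.≟ b
... | yes x≡b′ = x≡b′ , here refl
... | no x≢b   = contradiction x≡b x≢b
positions-complete b (x ∷ r) (suc i) e with x Bool.≟ b | positions-complete b r i e
... | yes _ | e′ , i∈ = e′ , there (∈-map⁺ suc-position i∈)
... | no _  | e′ , i∈ = e′ , ∈-map⁺ suc-position i∈

-- Hops are the edges of the particle graph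

lookup-ext : ∀ {m} {l l' : Vec Bool m} → (∀ i → lookup l i ≡ lookup l' i) → l ≡ l'
lookup-ext {l = l} {l'} same = trans (sym (tabulate∘lookup l)) (trans (tabulate-cong same) (tabulate∘lookup l'))

OneOf : ∀ {m} → Fin m → Fin m → Fin m → Set
OneOf a b x = x ≡ a ⊎ x ≡ b

record DifferExactlyAt {m} (v w : Vec Bool m) (P : Fin m → Set) : Set where
  constructor differ-at
  field
    differ⇒ : ∀ x → lookup v x ≢ lookup w x → P x
    ⇒differ : ∀ x → P x → lookup v x ≢ lookup w x
open DifferExactlyAt

differ-sym : ∀ {m} {v w : Vec Bool m} {P} → DifferExactlyAt v w P → DifferExactlyAt w v P
differ-sym d = differ-at (λ x ne → differ⇒ d x (ne ∘ sym)) (λ x px → ⇒differ d x px ∘ sym)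

differ-swap : ∀ {m} {v w : Vec Bool m} {a b} →
              DifferExactlyAt v w (OneOf a b) → DifferExactlyAt v w (OneOf b a)
differ-swap d = differ-at (λ x → swap ∘ differ⇒ d x) (λ x → ⇒differ d x ∘ swap)

fill-differs : ∀ {m} {l l' : Vec Bool m} → Fill l l' → ∃[ j ] DifferExactlyAt l l' (_≡ j)
fill-differs fill-here = zero , differ-at
  (λ { zero _ → refl ; (suc i) ne → contradiction refl ne })
  (λ { zero _ () ; (suc i) () })
fill-differs (fill-there f) with fill-differs f
... | j , d = suc j , differ-at
  (λ { zero ne → contradiction refl ne ; (suc i) ne → cong suc (differ⇒ d i ne) })
  (λ { zero () ; (suc i) e → ⇒differ d i (Fin.suc-injective e) })

differ-agree : ∀ {m} {l l' : Vec Bool m} {j} → DifferExactlyAt l l' (_≡ j) →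
               ∀ i → i ≢ j → lookup l i ≡ lookup l' i
differ-agree d i i≢j = decidable-stable (_ Bool.≟ _) (i≢j ∘ differ⇒ d i)

differs-fill : ∀ {m} {l l' : Vec Bool m} {j} → DifferExactlyAt l l' (_≡ j) → Fill l l' ⊎ Fill l' l
differs-fill {l = x ∷ l} {y ∷ l'} {zero} d with lookup-ext {l = l} {l'} (λ i → differ-agree d (suc i) λ ())
differs-fill {l = false ∷ _} {true ∷ _}  {zero} d | refl = inj₁ fill-here
differs-fill {l = true ∷ _}  {false ∷ _} {zero} d | refl = inj₂ fill-here
differs-fill {l = false ∷ _} {false ∷ _} {zero} d | refl = contradiction refl (⇒differ d zero refl)
differs-fill {l = true ∷ _}  {true ∷ _}  {zero} d | refl = contradiction refl (⇒differ d zero refl)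
differs-fill {l = x ∷ l} {y ∷ l'} {suc j} d
  with differ-agree d zero (λ ())
     | differs-fill (differ-at {v = l} {l'} (λ i → Fin.suc-injective ∘ differ⇒ d (suc i))
                                            (λ i → ⇒differ d (suc i) ∘ cong suc))
... | refl | inj₁ f = inj₁ (fill-there f)
... | refl | inj₂ f = inj₂ (fill-there f)

symDiff⇒≢ : ∀ {m} {v w : Vec Bool m} {x} →
            (x Subset.∈ v × x Subset.∉ w) ⊎ (x Subset.∈ w × x Subset.∉ v) → lookup v x ≢ lookup w x
symDiff⇒≢ {v = v} {w} {x} (inj₁ (x∈v , x∉w)) eq = x∉w (lookup⇒[]= x w (trans (sym eq) ([]=⇒lookup x∈v)))
symDiff⇒≢ {v = v} {w} {x} (inj₂ (x∈w , x∉v)) eq = x∉v (lookup⇒[]= x v (trans eq ([]=⇒lookup x∈w)))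

≢⇒symDiff : ∀ {m} {v w : Vec Bool m} {x} →
            lookup v x ≢ lookup w x → (x Subset.∈ v × x Subset.∉ w) ⊎ (x Subset.∈ w × x Subset.∉ v)
≢⇒symDiff {v = v} {w} {x} ne with lookup v x in ev | lookup w x in ew
... | true  | false = inj₁ (lookup⇒[]= x v ev , λ x∈w → contradiction (trans (sym ([]=⇒lookup x∈w)) ew) λ ())
... | false | true  = inj₂ (lookup⇒[]= x w ew , λ x∈v → contradiction (trans (sym ([]=⇒lookup x∈v)) ev) λ ())
... | true  | true  = contradiction refl ne
... | false | false = contradiction refl ne

symDiff⇒differ : ∀ {m} {v w : Vec Bool m} {a b} → SymDiffIs v w a b → DifferExactlyAt v w (OneOf a b)
symDiff⇒differ sd = differ-at (λ x → proj₁ (sd x) ∘ ≢⇒symDiff) (λ x → symDiff⇒≢ ∘ proj₂ (sd x))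

differ⇒symDiff : ∀ {m} {v w : Vec Bool m} {a b} → DifferExactlyAt v w (OneOf a b) → SymDiffIs v w a b
differ⇒symDiff d x = differ⇒ d x ∘ symDiff⇒≢ , ≢⇒symDiff ∘ ⇒differ d x

centre-and-leaf : ∀ {m c c'} {l l' : Vec Bool m} {j} → c ≢ c' → DifferExactlyAt l l' (_≡ j) →
                  DifferExactlyAt (c ∷ l) (c' ∷ l') (OneOf zero (suc j))
centre-and-leaf c≢c' d = differ-at
  (λ { zero _ → inj₁ refl ; (suc i) ne → inj₂ (cong suc (differ⇒ d i ne)) })
  (λ { zero _ → c≢c' ; (suc i) (inj₁ ()) ; (suc i) (inj₂ e) → ⇒differ d i (Fin.suc-injective e) })

hop-differs : ∀ {n} {v w : Vec Bool (suc n)} → Hop v w → ∃[ j ] DifferExactlyAt v w (OneOf zero (suc j))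
hop-differs (hop-out f) with fill-differs f
... | j , d = j , centre-and-leaf (λ ()) d
hop-differs (hop-in f) with fill-differs f
... | j , d = j , differ-sym (centre-and-leaf (λ ()) d)

leaves-differ : ∀ {m c c'} {l l' : Vec Bool m} {j} →
                DifferExactlyAt (c ∷ l) (c' ∷ l') (OneOf zero (suc j)) → DifferExactlyAt l l' (_≡ j)
leaves-differ d = differ-at
  (λ i → [ (λ ()) , Fin.suc-injective ]′ ∘ differ⇒ d (suc i))
  (λ i e → ⇒differ d (suc i) (inj₂ (cong suc e)))

2+n≢n : ∀ {n} → suc (suc n) ≢ n
2+n≢n e = <⇒≢ (m<n⇒m<1+n (n<1+n _)) (sym e)

differs-hop : ∀ {n} {v w : Vec Bool (suc n)} {j} → ∣ v ∣ ≡ ∣ w ∣ →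
              DifferExactlyAt v w (OneOf zero (suc j)) → Hop v w
differs-hop {v = true ∷ l} {false ∷ l'} |v|≡|w| d with differs-fill (leaves-differ d)
... | inj₁ f = hop-out f
... | inj₂ f = contradiction (trans (sym (cong suc (∣∣-fill f))) |v|≡|w|) 2+n≢n
differs-hop {v = false ∷ l} {true ∷ l'} |v|≡|w| d with differs-fill (leaves-differ d)
... | inj₂ f = hop-in f
... | inj₁ f = contradiction (trans (sym (cong suc (∣∣-fill f))) (sym |v|≡|w|)) 2+n≢n
differs-hop {v = true ∷ _}  {true ∷ _}  _ d = contradiction refl (⇒differ d zero (inj₁ refl))
differs-hop {v = false ∷ _} {false ∷ _} _ d = contradiction refl (⇒differ d zero (inj₁ refl))

Particles : ℕ → ℕ → Graph
Particles n k = ParticleGraph (suc n) (StarAdj n) k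

adjacent⇒hop : ∀ {n k} {u w : KSubset (suc n) k} → Graph.Adj (Particles n k) u w → Hop (proj₁ u) (proj₁ w)
adjacent⇒hop {u = _ , p} {_ , q} (_ , suc j , inj₁ (refl , _) , sd) =
  differs-hop (trans p (sym q)) (symDiff⇒differ sd)
adjacent⇒hop {u = _ , p} {_ , q} (suc j , _ , inj₂ (refl , _) , sd) =
  differs-hop (trans p (sym q)) (differ-swap (symDiff⇒differ sd))
adjacent⇒hop (_ , zero , inj₁ (refl , 0≢0) , _) = contradiction refl 0≢0
adjacent⇒hop (zero , _ , inj₂ (refl , 0≢0) , _) = contradiction refl 0≢0

hop⇒adjacent : ∀ {n k} {u w : KSubset (suc n) k} → Hop (proj₁ u) (proj₁ w) → Graph.Adj (Particles n k) u w
hop⇒adjacent h with hop-differs h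
... | j , d = zero , suc j , inj₁ (refl , λ ()) , differ⇒symDiff d

KSubset-≡ : ∀ {m k} {u w : KSubset m k} → proj₁ u ≡ proj₁ w → u ≡ w
KSubset-≡ {u = v , p} {.v , q} refl = cong (v ,_) (≡-irrelevant p q)

_≟ᵥ_ : ∀ {m} → DecidableEquality (Vec Bool m)
_≟ᵥ_ = Vec.≡-dec Bool._≟_

_≟ₖ_ : ∀ {m k} → DecidableEquality (KSubset m k)
u ≟ₖ w with proj₁ u ≟ᵥ proj₁ w
... | yes eq = yes (KSubset-≡ eq)
... | no ne  = no (ne ∘ cong proj₁)

∣∁∣≡ : ∀ {m k h} (v : Vec Bool m) → k + h ≡ m → ∣ v ∣ ≡ k → ∣ ∁ v ∣ ≡ h
∣∁∣≡ {m} {k} {h} v k+h≡m |v|≡k = begin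
  ∣ ∁ v ∣      ≡⟨ ∣∁p∣≡n∸∣p∣ v ⟩
  m ∸ ∣ v ∣    ≡⟨ cong₂ _∸_ (sym k+h≡m) |v|≡k ⟩
  k + h ∸ k    ≡⟨ m+n∸m≡n k h ⟩
  h            ∎
  where open ≡-Reasoning

∁-KSubset : ∀ {n k k'} → k + k' ≡ suc n → KSubset (suc n) k → KSubset (suc n) k'
∁-KSubset k+k'≡1+n (v , |v|≡k) = ∁ v , ∣∁∣≡ v k+k'≡1+n |v|≡k

particles-∁-≅ : ∀ {n k k'} → k + k' ≡ suc n → Particles n k ≅ Particles n k'
particles-∁-≅ {n} {k} {k'} k+k'≡1+n = record
  { to       = ∁-KSubset k+k'≡1+n
  ; from     = ∁-KSubset k'+k≡1+n
  ; from∘to  = λ u → KSubset-≡ (∁-involutive (proj₁ u))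
  ; to∘from  = λ u → KSubset-≡ (∁-involutive (proj₁ u))
  ; to-adj   = λ {a} {b} adj → hop⇒adjacent {u = ∁-KSubset k+k'≡1+n a} {∁-KSubset k+k'≡1+n b}
                                  (hop-∁ (adjacent⇒hop {u = a} {b} adj))
  ; from-adj = λ {a} {b} adj → hop⇒adjacent {u = ∁-KSubset k'+k≡1+n a} {∁-KSubset k'+k≡1+n b}
                                  (hop-∁ (adjacent⇒hop {u = a} {b} adj))
  }
  where k'+k≡1+n = trans (+-comm k' k) k+k'≡1+n

-- Removing few configurations keeps the hop graph connected

-- For k particles and h holes, t must stay below the degrees k and h of the configurations
-- with empty and with occupied centre.
Removable : ℕ → ℕ → ℕ → Set
Removable k h t = t ≡ 0 ⊎ (t < k × t < h)

removable-swap : ∀ {k h t} → Removable k h t → Removable h k t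
removable-swap = map₂ Product.swap

removable-< : ∀ {k h t} → Removable k (suc h) t → 0 < k → t < k × t < suc h
removable-< (inj₁ refl) 0<k = 0<k , s≤s z≤n
removable-< (inj₂ t<)   _   = t<

removable-split : ∀ {k h t t₀ t₁} → 0 < k + h → t₀ + t₁ ≡ t → Removable k h t →
                  (∃[ h' ] h ≡ suc h' × Removable k h' t₀) ⊎ (∃[ k' ] k ≡ suc k' × Removable k' h t₁)
removable-split {h = suc h'} {t₀ = t₀} _ t₀+t₁≡t (inj₁ refl) =
  inj₁ (h' , refl , inj₁ (m+n≡0⇒m≡0 t₀ t₀+t₁≡t))
removable-split {suc k'} {zero} {t₀ = t₀} _ t₀+t₁≡t (inj₁ refl) =
  inj₂ (k' , refl , inj₁ (m+n≡0⇒n≡0 t₀ t₀+t₁≡t))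
removable-split {suc k'} {suc h'} {t} {t₀} {t₁} _ t₀+t₁≡t (inj₂ (t<k , t<h)) with t₀ <? h'
... | yes t₀<h' = inj₁ (h' , refl , inj₂ (≤-<-trans t₀≤t t<k , t₀<h'))
  where t₀≤t = subst (t₀ ≤_) t₀+t₁≡t (m≤m+n t₀ t₁)
... | no t₀≮h'  = inj₂ (k' , refl , inj₁ (n≤0⇒n≡0 (+-cancelˡ-≤ t₀ t₁ 0 t₀+t₁≤t₀+0)))
  where
    t₀+t₁≤t₀+0 : t₀ + t₁ ≤ t₀ + 0
    t₀+t₁≤t₀+0 = begin
      t₀ + t₁ ≡⟨ t₀+t₁≡t ⟩
      t       ≤⟨ ≤-pred t<h ⟩
      h'      ≤⟨ ≮⇒≥ t₀≮h' ⟩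
      t₀      ≡⟨ sym (+-identityʳ t₀) ⟩
      t₀ + 0  ∎
      where open ≤-Reasoning

addLeaf : ∀ {n} → Bool → Vec Bool (suc n) → Vec Bool (suc (suc n))
addLeaf z (c ∷ r) = c ∷ z ∷ r

hop-addLeaf : ∀ {n} z {a b : Vec Bool (suc n)} → Hop a b → Hop (addLeaf z a) (addLeaf z b)
hop-addLeaf z (hop-out f) = hop-out (fill-there f)
hop-addLeaf z (hop-in f)  = hop-in (fill-there f)

slice : ∀ {n} → Bool → List (Vec Bool (suc (suc n))) → List (Vec Bool (suc n))
slice z []                 = []
slice z ((c ∷ z' ∷ r) ∷ T) with z' Bool.≟ z
... | yes _ = (c ∷ r) ∷ slice z T
... | no _  = slice z T

∈-slice⁺ : ∀ {n} z {v : Vec Bool (suc n)} T → addLeaf z v ∈ T → v ∈ slice z T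
∈-slice⁺ z {c ∷ r} ((_ ∷ _ ∷ _) ∷ T) (here refl) with z Bool.≟ z
... | yes _  = here refl
... | no z≢z = contradiction refl z≢z
∈-slice⁺ z ((_ ∷ z' ∷ _) ∷ T) (there v∈T) with z' Bool.≟ z
... | yes _ = there (∈-slice⁺ z T v∈T)
... | no _  = ∈-slice⁺ z T v∈T

∈-slice⁻ : ∀ {n} z {v : Vec Bool (suc n)} T → v ∈ slice z T → addLeaf z v ∈ T
∈-slice⁻ z ((_ ∷ z' ∷ _) ∷ T) v∈ with z' Bool.≟ z
∈-slice⁻ z ((_ ∷ z' ∷ _) ∷ T) (here refl) | yes refl = here refl
∈-slice⁻ z ((_ ∷ z' ∷ _) ∷ T) (there v∈)  | yes refl = there (∈-slice⁻ z T v∈)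
∈-slice⁻ z ((_ ∷ z' ∷ _) ∷ T) v∈          | no _     = there (∈-slice⁻ z T v∈)

length-slices : ∀ {n} (T : List (Vec Bool (suc (suc n)))) →
                length (slice false T) + length (slice true T) ≡ length T
length-slices []                     = refl
length-slices ((_ ∷ false ∷ _) ∷ T) = cong suc (length-slices T)
length-slices ((_ ∷ true ∷ _) ∷ T)  = trans (+-suc _ _) (cong suc (length-slices T))

length-slice-∁ : ∀ {n} (T : List (Vec Bool (suc (suc n)))) →
                 length (slice false (map ∁ T)) ≡ length (slice true T)
length-slice-∁ []                     = refl
length-slice-∁ ((_ ∷ false ∷ _) ∷ T) = length-slice-∁ T
length-slice-∁ ((_ ∷ true ∷ _) ∷ T)  = cong suc (length-slice-∁ T)

record Landing {n} (T : List (Vec Bool (suc (suc n)))) (u : Vec Bool (suc (suc n))) : Set where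
  constructor landing
  field
    target   : Vec Bool (suc n)
    target∉T : addLeaf false target ∉ T
    route    : Reach (HopGraph (suc n)) T u (addLeaf false target)

disjoint-by-bit : ∀ {m b} (i : Fin m) {xs ys : List (Vec Bool m)} →
                  All (λ v → lookup v i ≡ b) xs → All (λ v → lookup v i ≡ not b) ys → Disjoint xs ys
disjoint-by-bit i xs-b ys-¬b (v∈xs , v∈ys) = not-¬ (All.lookup xs-b v∈xs) (All.lookup ys-¬b v∈ys)

occupied≢empty : ∀ {m} (r : Vec Bool m) {i j} → lookup r i ≡ true → lookup r j ≡ false → i ≢ j
occupied≢empty _ ri rj refl = not-¬ ri rj

some-position : ∀ {m} b (r : Vec Bool m) → 0 < length (positions b r) → Position r b
some-position b r 0<len with positions b r
... | p ∷ _ = p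
... | []    = contradiction 0<len λ ()

count-empty : ∀ {m h} (r : Vec Bool m) → ∣ r ∣ + h ≡ m → length (positions false r) ≡ h
count-empty {h = h} r |r|+h≡m =
  +-cancelʳ-≡ ∣ r ∣ _ h (trans (length-positions-false r) (trans (sym |r|+h≡m) (+-comm ∣ r ∣ h)))

-- Routes from centre and first leaf occupied: the centre particle jumps to the empty leaf j,
-- then the first-leaf particle to the centre.
via-empty-leaf : ∀ {n} (r : Vec Bool n) → Position r false → List (Vec Bool (suc (suc n)))
via-empty-leaf r (j , _) = (false ∷ true ∷ r [ j ]≔ true) ∷ (true ∷ false ∷ r [ j ]≔ true) ∷ []

via-empty-leaves-disjoint : ∀ {n} (r : Vec Bool n) → AllPairs (Disjoint on via-empty-leaf r) (positions false r)
via-empty-leaves-disjoint r = AllPairs.map (λ {x} {y} → disjoint x y) (positions-distinct false r)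
  where
    disjoint : ∀ x y → proj₁ x ≢ proj₁ y → Disjoint (via-empty-leaf r x) (via-empty-leaf r y)
    disjoint (i , ri) (j , _) i≢j = disjoint-by-bit (suc (suc i)) (filled ∷ filled ∷ []) (empty ∷ empty ∷ [])
      where
        filled = lookup∘update i r true
        empty  = trans (lookup∘update′ i≢j r true) ri

escape-full-centre : ∀ {n} T (r : Vec Bool n) → length T < length (positions false r) →
                     true ∷ true ∷ r ∉ T → Landing T (true ∷ true ∷ r)
escape-full-centre T r bound u∉T
  with avoiding-member _≟ᵥ_ (via-empty-leaf r) T (positions false r) (via-empty-leaves-disjoint r) bound
... | (j , rj) , _ , v∉T ∷ w∉T ∷ [] = landing (true ∷ r [ j ]≔ true) w∉T
  (step u∉T (hop-out (fill-there (fill-at r j rj))) (step v∉T (hop-in fill-here) (here w∉T)))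

-- Routes from empty centre and occupied first leaf: the first-leaf particle jumps to the centre,
-- either at once or after the particle at i has jumped to the centre and on to the empty leaf j.
via-particle : ∀ {n} (r : Vec Bool n) → Position r false → Maybe (Position r true) →
               List (Vec Bool (suc (suc n)))
via-particle r _       nothing        = (true ∷ false ∷ r) ∷ []
via-particle r (j , _) (just (i , _)) =
  (true ∷ true ∷ r [ i ]≔ false) ∷ (false ∷ true ∷ r [ i ]≔ false [ j ]≔ true) ∷
  (true ∷ false ∷ r [ i ]≔ false [ j ]≔ true) ∷ []

via-particles-disjoint : ∀ {n} (r : Vec Bool n) hole →
                         AllPairs (Disjoint on via-particle r hole) (nothing ∷ map just (positions true r))
via-particles-disjoint r (j , rj) =
  All.map⁺ (All.universal direct-vs-detour _) ∷
  AllPairs.map⁺ (AllPairs.map (λ {x} {y} → detour-vs-detour x y) (positions-distinct true r))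
  where
    emptied : ∀ i (ri : lookup r i ≡ true) →
              All (λ v → lookup v (suc (suc i)) ≡ false) (via-particle r (j , rj) (just (i , ri)))
    emptied i ri = ri' ∷ rij ∷ rij ∷ []
      where
        ri' = lookup∘update i r false
        rij = trans (lookup∘update′ (occupied≢empty r ri rj) (r [ i ]≔ false) true) ri'
    direct-vs-detour : ∀ y → Disjoint (via-particle r (j , rj) nothing) (via-particle r (j , rj) (just y))
    direct-vs-detour (i , ri) = disjoint-by-bit (suc (suc i)) (ri ∷ []) (emptied i ri)
    detour-vs-detour : ∀ x y → proj₁ x ≢ proj₁ y →
                       Disjoint (via-particle r (j , rj) (just x)) (via-particle r (j , rj) (just y))
    detour-vs-detour (i , ri) (i' , _) i≢i' =
      disjoint-by-bit (suc (suc i)) (emptied i ri) (rii' ∷ rii'j ∷ rii'j ∷ [])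
      where
        rii'  = trans (lookup∘update′ i≢i' r false) ri
        rii'j = trans (lookup∘update′ (occupied≢empty r ri rj) (r [ i' ]≔ false) true) rii'

escape-empty-centre : ∀ {n} T (r : Vec Bool n) → Position r false → length T < suc ∣ r ∣ →
                      false ∷ true ∷ r ∉ T → Landing T (false ∷ true ∷ r)
escape-empty-centre T r hole@(j , rj) bound u∉T
  with avoiding-member _≟ᵥ_ (via-particle r hole) T (nothing ∷ map just (positions true r))
                       (via-particles-disjoint r hole) bound′
  where
    bound′ = subst (λ c → length T < suc c)
                   (sym (trans (length-map just (positions true r)) (length-positions-true r))) bound
... | nothing , _ , w∉T ∷ [] = landing (true ∷ r) w∉T (step u∉T (hop-in fill-here) (here w∉T))
... | just (i , ri) , _ , v₁∉T ∷ v₂∉T ∷ w∉T ∷ [] = landing (true ∷ s [ j ]≔ true) w∉T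
  (step u∉T (hop-in (fill-there (vacate-at r i ri)))
  (step v₁∉T (hop-out (fill-there (fill-at s j sj)))
  (step v₂∉T (hop-in fill-here) (here w∉T))))
  where
    s  = r [ i ]≔ false
    sj = trans (lookup∘update′ (occupied≢empty r ri rj ∘ sym) r false) rj

∣addLeaf-false∣ : ∀ {n} (v : Vec Bool (suc n)) → ∣ addLeaf false v ∣ ≡ ∣ v ∣
∣addLeaf-false∣ (true ∷ _)  = refl
∣addLeaf-false∣ (false ∷ _) = refl

escape : ∀ {n k h} T (u : Vec Bool (suc (suc n))) → k + suc h ≡ suc (suc n) → ∣ u ∣ ≡ k →
         Removable k (suc h) (length T) → u ∉ T → Landing T u
escape T (c ∷ false ∷ r) _ _ _ u∉T = landing (c ∷ r) u∉T (here u∉T)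
escape T (true ∷ true ∷ r) k+1+h≡ refl removable u∉T =
  escape-full-centre T r (subst (length T <_) (sym (count-empty r |r|+1+h≡)) t<1+h) u∉T
  where
    t<1+h     = proj₂ (removable-< removable (s≤s z≤n))
    |r|+1+h≡ = suc-injective (suc-injective k+1+h≡)
escape [] (false ∷ true ∷ r) _ _ _ u∉T = landing (true ∷ r) (λ ()) (step u∉T (hop-in fill-here) (here λ ()))
escape {h = h} T@(_ ∷ _) (false ∷ true ∷ r) k+1+h≡ refl removable u∉T =
  escape-empty-centre T r (some-position false r 0<holes) t<k u∉T
  where
    t<k         = proj₁ (removable-< removable (s≤s z≤n))
    t<1+h       = proj₂ (removable-< removable (s≤s z≤n))
    |r|+h≡      = suc-injective (trans (sym (+-suc ∣ r ∣ h)) (suc-injective k+1+h≡))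
    0<holes     = subst (0 <_) (sym (count-empty r |r|+h≡)) (≤-trans (s≤s z≤n) (≤-pred t<1+h))

StaysConnected : ℕ → Set
StaysConnected n = ∀ {k h} → k + h ≡ suc n → (T : List (Vec Bool (suc n))) → Removable k h (length T) →
                   ∀ {u w} → ∣ u ∣ ≡ k → ∣ w ∣ ≡ k → u ∉ T → w ∉ T → Reach (HopGraph n) T u w

stays-connected-base : StaysConnected zero
stays-connected-base _ _ _ {true ∷ []}  {true ∷ []}  _ _ u∉T _ = here u∉T
stays-connected-base _ _ _ {false ∷ []} {false ∷ []} _ _ u∉T _ = here u∉T
stays-connected-base _ _ _ {true ∷ []}  {false ∷ []} |u| |w| _ _ = contradiction (trans |u| (sym |w|)) λ ()
stays-connected-base _ _ _ {false ∷ []} {true ∷ []}  |u| |w| _ _ = contradiction (trans |u| (sym |w|)) λ ()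

stays-connected-via-empty-leaf : ∀ {n} → StaysConnected n →
  ∀ {k h} → k + suc h ≡ suc (suc n) → (T : List (Vec Bool (suc (suc n)))) →
  Removable k (suc h) (length T) → Removable k h (length (slice false T)) →
  ∀ {u w} → ∣ u ∣ ≡ k → ∣ w ∣ ≡ k → u ∉ T → w ∉ T → Reach (HopGraph (suc n)) T u w
stays-connected-via-empty-leaf {n} connected {k} {h} k+1+h≡ T removable removable₀ |u| |w| u∉T w∉T
  with escape T _ k+1+h≡ |u| removable u∉T | escape T _ k+1+h≡ |w| removable w∉T
... | landing u' u'∉T route-u | landing w' w'∉T route-w =
  reach-trans route-u (reach-trans (reach-map (addLeaf false) (hop-addLeaf false) (∈-slice⁺ false T) inside)
                                   (reach-sym hop-sym route-w))
  where
    k+h≡ = suc-injective (trans (sym (+-suc k h)) k+1+h≡)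
    |landing| : ∀ {v} v' → ∣ v ∣ ≡ k → Reach (HopGraph (suc n)) T v (addLeaf false v') → ∣ v' ∣ ≡ k
    |landing| v' |v| route = trans (sym (∣addLeaf-false∣ v')) (trans (sym (∣∣-reach route)) |v|)
    inside = connected k+h≡ (slice false T) removable₀ (|landing| u' |u| route-u) (|landing| w' |w| route-w)
                       (u'∉T ∘ ∈-slice⁻ false T) (w'∉T ∘ ∈-slice⁻ false T)

∁-∉ : ∀ {m} {u : Vec Bool m} {T} → u ∉ T → ∁ u ∉ map ∁ T
∁-∉ {u = u} u∉T ∁u∈ with ∈-map⁻ ∁ ∁u∈
... | x , x∈T , ∁u≡∁x =
  u∉T (subst (_∈ _) (trans (sym (∁-involutive x)) (trans (cong ∁ (sym ∁u≡∁x)) (∁-involutive u))) x∈T)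

reach-∁ : ∀ {n T} {u w : Vec Bool (suc n)} →
          Reach (HopGraph n) (map ∁ T) (∁ u) (∁ w) → Reach (HopGraph n) T u w
reach-∁ {T = T} {u} {w} route =
  subst₂ (Reach _ T) (∁-involutive u) (∁-involutive w) (reach-map ∁ hop-∁ pull route)
  where
    pull : ∀ {a} → ∁ a ∈ T → a ∈ map ∁ T
    pull {a} ∁a∈T = subst (_∈ map ∁ T) (∁-involutive a) (∈-map⁺ ∁ ∁a∈T)

-- If the removed set is too large for the slice with empty first leaf, then the complement,
-- which exchanges particles and holes, lets the slice with occupied first leaf play that role.
stays-connected : ∀ n → StaysConnected n
stays-connected zero = stays-connected-base
stays-connected (suc n) {k} {h} k+h≡ T removable {u} {w} |u| |w| u∉T w∉T
  with removable-split {t₀ = length (slice false T)} {length (slice true T)}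
                       (subst (0 <_) (sym k+h≡) (s≤s z≤n)) (length-slices T) removable
... | inj₁ (h' , refl , removable₀) =
  stays-connected-via-empty-leaf (stays-connected n) k+h≡ T removable removable₀ |u| |w| u∉T w∉T
... | inj₂ (k' , refl , removable₁) =
  reach-∁ (stays-connected-via-empty-leaf (stays-connected n) (trans (+-comm h (suc k')) k+h≡) (map ∁ T)
             (subst (Removable h (suc k')) (sym (length-map ∁ T)) (removable-swap removable))
             (subst (Removable h k') (sym (length-slice-∁ T)) (removable-swap removable₁))
             (∣∁∣≡ u k+h≡ |u|) (∣∁∣≡ w k+h≡ |w|) (∁-∉ u∉T) (∁-∉ w∉T))

∉-proj₁ : ∀ {m k} {u : KSubset m k} {S} → u ∉ S → proj₁ u ∉ map proj₁ S
∉-proj₁ u∉S u∈ with ∈-map⁻ proj₁ u∈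
... | x , x∈S , eq = u∉S (subst (_∈ _) (sym (KSubset-≡ eq)) x∈S)

reach-particles : ∀ {n k S} {v w : Vec Bool (suc n)} → Reach (HopGraph n) (map proj₁ S) v w →
                  (p : ∣ v ∣ ≡ k) (q : ∣ w ∣ ≡ k) → Reach (Particles n k) S (v , p) (w , q)
reach-particles (here v∉) p q rewrite ≡-irrelevant p q = here (v∉ ∘ ∈-map⁺ proj₁)
reach-particles {v = v} (step {w = v'} v∉ h route) p q =
  step (v∉ ∘ ∈-map⁺ proj₁) (hop⇒adjacent {u = v , p} {v' , p'} h) (reach-particles route p' q)
  where p' = trans (sym (∣∣-hop h)) p

particles-connected : ∀ {n k h} → k + h ≡ suc n → (S : List (KSubset (suc n) k)) →
                      Removable k h (length S) → ConnectedWithout (Particles n k) S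
particles-connected {n} {k} {h} k+h≡ S removable (v , p) (w , q) v∉S w∉S =
  reach-particles (stays-connected n k+h≡ (map proj₁ S) removable′ p q (∉-proj₁ v∉S) (∉-proj₁ w∉S)) p q
  where removable′ = subst (Removable k h) (sym (length-map proj₁ S)) removable

-- Vertex connectivity

module CentreEmpty {n k} (r : Vec Bool n) (|r|≡k : ∣ r ∣ ≡ k) where

  vertex : KSubset (suc n) k
  vertex = false ∷ r , |r|≡k

  vacate : Position r true → KSubset (suc n) k
  vacate (i , ri) = true ∷ r [ i ]≔ false , trans (sym (∣∣-fill (vacate-at r i ri))) |r|≡k

  neighbours : List (KSubset (suc n) k)
  neighbours = map vacate (positions true r)

  length-neighbours : length neighbours ≡ k
  length-neighbours = trans (length-map vacate (positions true r)) (trans (length-positions-true r) |r|≡k)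

  neighbours-unique : Unique neighbours
  neighbours-unique = AllPairs.map⁺ (AllPairs.map (λ {x} {y} → distinct x y) (positions-distinct true r))
    where
      distinct : ∀ x y → proj₁ x ≢ proj₁ y → vacate x ≢ vacate y
      distinct (i , ri) (j , _) i≢j eq =
        not-¬ (lookup∘update i r false)
              (trans (cong (λ v → lookup (proj₁ v) (suc i)) eq) (trans (lookup∘update′ i≢j r false) ri))

  neighbours-complete : ∀ v → Graph.Adj (Particles n k) vertex v → v ∈ neighbours
  neighbours-complete (v , q) adj with adjacent⇒hop {u = vertex} {v , q} adj
  ... | hop-in f with fill⇒vacate f
  ...   | i , ri , refl with positions-complete true r i ri
  ...     | _ , i∈ = subst (_∈ neighbours) (KSubset-≡ refl) (∈-map⁺ vacate i∈)

  centre-occupied : ∀ {c l} {p : ∣ c ∷ l ∣ ≡ k} → (c ∷ l , p) ∈ neighbours → c ≡ true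
  centre-occupied v∈ with ∈-map⁻ vacate v∈
  ... | _ , _ , refl = refl

  vertex-∉-neighbours : ∀ {l} {p : ∣ false ∷ l ∣ ≡ k} → (false ∷ l , p) ∉ neighbours
  vertex-∉-neighbours v∈ = contradiction (centre-occupied v∈) λ ()

  neighbours-separate : Position r true → Position r false → Separating (Particles n k) neighbours
  neighbours-separate (i , ri) (j , rj) =
    isolated-separates neighbours-complete vertex-∉-neighbours vertex-∉-neighbours vertex≢other
    where
      s  = r [ i ]≔ false
      sj = trans (lookup∘update′ (occupied≢empty r ri rj ∘ sym) r false) rj
      |s[j]≔true|≡k = trans (∣∣-fill (fill-at s j sj)) (trans (sym (∣∣-fill (vacate-at r i ri))) |r|≡k)
      other : KSubset (suc n) k
      other = false ∷ s [ j ]≔ true , |s[j]≔true|≡k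
      vertex≢other : vertex ≢ other
      vertex≢other eq = not-¬ rj (trans (cong (λ v → lookup (proj₁ v) (suc j)) eq) (lookup∘update j s true))

  no-smaller-separator : ∀ {h} → k + h ≡ suc n → k ≤ h →
                         ∀ S → Unique S → length S < k → ¬ Separating (Particles n k) S
  no-smaller-separator k+h≡ k≤h S _ |S|<k (inj₁ disconnected) =
    disconnected (particles-connected k+h≡ S (inj₂ (|S|<k , <-≤-trans |S|<k k≤h)))
  no-smaller-separator _ _ S _ |S|<k (inj₂ atMostOne) =
    not-atMostOneLeft {Particles n k} _≟ₖ_ (vertex-distinct ∷ neighbours-unique)
      (s≤s (subst (suc (length S) ≤_) (sym length-neighbours) |S|<k)) atMostOne
    where
      vertex-distinct : All (vertex ≢_) neighbours
      vertex-distinct = All.tabulate λ v∈ eq → vertex-∉-neighbours (subst (_∈ neighbours) (sym eq) v∈)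

some-configuration : ∀ {n k} → k ≤ n → Σ (Vec Bool n) λ r → ∣ r ∣ ≡ k
some-configuration {zero}  z≤n     = [] , refl
some-configuration {suc n} z≤n     = Product.map (false ∷_) id (some-configuration {n} z≤n)
some-configuration {suc n} (s≤s k≤n) = Product.map (true ∷_) (cong suc) (some-configuration k≤n)

κ-particles-1-1 : IsVertexConnectivity (Particles 1 1) 1
κ-particles-1-1 =
  (neighbours , neighbours-unique , length-neighbours ,
   inj₂ λ u w u∉ w∉ → trans (only-vertex u u∉) (sym (only-vertex w w∉))) ,
  no-smaller-separator refl ≤-refl
  where
    open CentreEmpty (true ∷ []) refl
    only-vertex : ∀ v → v ∉ neighbours → v ≡ vertex
    only-vertex (true ∷ false ∷ [] , _) v∉ = contradiction (here (KSubset-≡ refl)) v∉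
    only-vertex (false ∷ true ∷ [] , _) _  = KSubset-≡ refl
    only-vertex (true ∷ true ∷ [] , ())
    only-vertex (false ∷ false ∷ [] , ())

κ-particles : ∀ {n k h} → k + h ≡ suc n → 1 ≤ k → k ≤ h → IsVertexConnectivity (Particles n k) k
κ-particles {k = zero} _ () _
κ-particles {k = suc _} {zero} _ _ ()
κ-particles {k = suc zero} {suc zero} refl _ _ = κ-particles-1-1
κ-particles {k = suc (suc _)} {suc zero} _ _ (s≤s ())
κ-particles {n} {k} {suc (suc h)} k+h≡ 1≤k k≤h =
  (neighbours , neighbours-unique , length-neighbours , neighbours-separate occupied empty) ,
  no-smaller-separator k+h≡ k≤h
  where
    k<n : k < n
    k<n = subst (k <_) (suc-injective (trans (sym (+-suc k (suc h))) k+h≡)) (m<m+n k (s≤s z≤n))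
    r = proj₁ (some-configuration (<⇒≤ k<n))
    |r|≡k = proj₂ (some-configuration (<⇒≤ k<n))
    open CentreEmpty r |r|≡k
    occupied = some-position true r (subst (0 <_) (sym (trans (length-positions-true r) |r|≡k)) 1≤k)
    empty    = some-position false r (n≢0⇒n>0 λ none → <⇒≢ k<n
                 (trans (sym |r|≡k) (trans (cong (_+ ∣ r ∣) (sym none)) (length-positions-false r))))

star-connected : ∀ n → ConnectedWithout (Star n) []
star-connected n zero    zero    u∉ w∉ = here u∉
star-connected n zero    (suc _) u∉ w∉ = step u∉ (inj₁ (refl , λ ())) (here w∉)
star-connected n (suc _) zero    u∉ w∉ = step u∉ (inj₂ (refl , λ ())) (here w∉)
star-connected n (suc _) (suc _) u∉ w∉ =
  step u∉ (inj₂ (refl , λ ())) (step (λ ()) (inj₁ (refl , λ ())) (here w∉))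

centre-separates : ∀ n → Separating (Star (suc n)) (zero ∷ [])
centre-separates zero = inj₂ λ
  { zero _ u∉ _ → contradiction (here refl) u∉
  ; _ zero _ w∉ → contradiction (here refl) w∉
  ; (suc zero) (suc zero) _ _ → refl }
centre-separates (suc n) =
  isolated-separates {Star (suc (suc n))} {w = suc (suc zero)} leaf-isolated (λ { (here ()) }) (λ { (here ()) }) λ ()
  where
    leaf-isolated : ∀ v → StarAdj (suc (suc n)) (suc zero) v → v ∈ zero ∷ []
    leaf-isolated v (inj₂ (refl , _)) = here refl

κ-star : ∀ n → 1 ≤ n → IsVertexConnectivity (Star n) 1
κ-star (suc n) _ = (zero ∷ [] , [] ∷ [] , refl , centre-separates n) , no-smaller
  where
    no-smaller : ∀ S → Unique S → length S < 1 → ¬ Separating (Star (suc n)) S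
    no-smaller [] _ _ (inj₁ disconnected) = disconnected (star-connected (suc n))
    no-smaller [] _ _ (inj₂ atMostOne)    = contradiction (atMostOne zero (suc zero) (λ ()) (λ ())) λ ()
    no-smaller (_ ∷ _) _ (s≤s ())

half-≤ : ∀ {a b c} → a + b ≡ c → 2 * a ≤ c → a ≤ b
half-≤ {a} {b} {c} a+b≡c 2a≤c = +-cancelˡ-≤ a a b (begin
  a + a       ≡⟨ cong (a +_) (sym (+-identityʳ a)) ⟩
  2 * a       ≤⟨ 2a≤c ⟩
  c           ≡⟨ sym a+b≡c ⟩
  a + b       ∎)
  where open ≤-Reasoning

half-≥ : ∀ {a b c} → a + b ≡ c → c ≤ 2 * a → b ≤ a
half-≥ {a} {b} {c} a+b≡c c≤2a = +-cancelˡ-≤ a b a (begin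
  a + b       ≡⟨ a+b≡c ⟩
  c           ≤⟨ c≤2a ⟩
  2 * a       ≡⟨ cong (a +_) (+-identityʳ a) ⟩
  a + a       ∎)
  where open ≤-Reasoning

corollary3p10 : (n k : ℕ) → 1 ≤ k → k ≤ n →
    IsVertexConnectivity (Star n) 1 ×
    (2 * k ≤ n + 1 → IsVertexConnectivity (ParticleGraph (suc n) (StarAdj n) k) k) ×
    (n + 1 ≤ 2 * k → IsVertexConnectivity (ParticleGraph (suc n) (StarAdj n) k) (n + 1 ∸ k))
corollary3p10 n k 1≤k k≤n =
  κ-star n (≤-trans 1≤k k≤n) ,
  (λ 2k≤n+1 → κ-particles k+k̄≡1+n 1≤k (half-≤ k+k̄≡n+1 2k≤n+1)) ,
  (λ n+1≤2k → vertexConnectivity-≅ (particles-∁-≅ k̄+k≡1+n)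
                                    (κ-particles k̄+k≡1+n 1≤k̄ (half-≥ k+k̄≡n+1 n+1≤2k)))
  where
    k<n+1     = subst (k <_) (+-comm 1 n) (s≤s k≤n)
    k+k̄≡n+1  = m+[n∸m]≡n (<⇒≤ k<n+1)
    k+k̄≡1+n  = trans k+k̄≡n+1 (+-comm n 1)
    k̄+k≡1+n  = trans (+-comm (n + 1 ∸ k) k) k+k̄≡1+n
    1≤k̄      = m<n⇒0<n∸m k<n+1
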